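{- Let $G_1$ and $G_2$ be vertex-disjoint graphs with $n_1$ and $n_2$ vertices respectively. Then $$\pi(G_1\cup G_2)=\max\{\pi(G_1),\pi(G_2)\},\qquad \pi(G_1\vee G_2)=\min\{\pi(G_1)+n_2,\ \pi(G_2)+n_1\}.$$
   Context: $G_1\cup G_2$ is the disjoint union; $G_1\vee G_2$ (join) is the disjoint union together with all edges $uv$, $u\in V(G_1)$, $v\in V(G_2)$. A $P_4$ is an induced path on four vertices. A coloring is a partition of the vertex set into color classes; it is proper if each class is stable; acyclic if proper and every cycle gets at least three colors; star if acyclic and every $P_4$ gets at least three colors; nonrepetitive if it is a star coloring and no path $v_1\cdots v_{2p}$ ($p\ge1$, distinct vertices, consecutive adjacent) has $v_i$ and $v_{i+p}$ of the same color for all $1\le i\le p$. $\pi(G)$ is the minimum number of colors in a nonrepetitive coloring of $G$. -}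

module Defs where

open import Data.Bool using (Bool; true; false; T)
open import Data.Nat using (ℕ; zero; suc; _+_; _≤_)
open import Data.Fin using (Fin; zero; suc; inject₁; fromℕ; splitAt; _↑ˡ_; _↑ʳ_)
open import Data.Sum using (_⊎_; inj₁; inj₂)
open import Data.Product using (Σ; ∃; ∃-syntax; _×_; _,_)
open import Data.Empty using (⊥)
open import Relation.Nullary using (¬_)
open import Relation.Binary.PropositionalEquality using (_≡_; _≢_; refl)
open import Function.Definitions using (Injective)

record Graph (n : ℕ) : Set where
  field
    adj   : Fin n → Fin n → Bool
    sym   : ∀ u v → adj u v ≡ adj v u
    irrefl : ∀ u → adj u u ≡ false
open Graph public

Adj : ∀ {n} → Graph n → Fin n → Fin n → Set
Adj G u v = T (adj G u v)

-- adjacency on a disjoint sum of vertex sets; `cross` says whether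
-- vertices from different sides are adjacent (false: union, true: join)
sumAdj : ∀ {n₁ n₂} → (Fin n₁ → Fin n₁ → Bool) → (Fin n₂ → Fin n₂ → Bool) → Bool →
         Fin n₁ ⊎ Fin n₂ → Fin n₁ ⊎ Fin n₂ → Bool
sumAdj a₁ a₂ c (inj₁ x) (inj₁ y) = a₁ x y
sumAdj a₁ a₂ c (inj₂ x) (inj₂ y) = a₂ x y
sumAdj a₁ a₂ c (inj₁ x) (inj₂ y) = c
sumAdj a₁ a₂ c (inj₂ x) (inj₁ y) = c

sumAdj-sym : ∀ {n₁ n₂} (G₁ : Graph n₁) (G₂ : Graph n₂) c x y →
  sumAdj (adj G₁) (adj G₂) c x y ≡ sumAdj (adj G₁) (adj G₂) c y x
sumAdj-sym G₁ G₂ c (inj₁ x) (inj₁ y) = sym G₁ x y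
sumAdj-sym G₁ G₂ c (inj₂ x) (inj₂ y) = sym G₂ x y
sumAdj-sym G₁ G₂ c (inj₁ x) (inj₂ y) = refl
sumAdj-sym G₁ G₂ c (inj₂ x) (inj₁ y) = refl

sumAdj-irrefl : ∀ {n₁ n₂} (G₁ : Graph n₁) (G₂ : Graph n₂) c x →
  sumAdj (adj G₁) (adj G₂) c x x ≡ false
sumAdj-irrefl G₁ G₂ c (inj₁ x) = irrefl G₁ x
sumAdj-irrefl G₁ G₂ c (inj₂ x) = irrefl G₂ x

sumGraph : ∀ {n₁ n₂} → Graph n₁ → Graph n₂ → Bool → Graph (n₁ + n₂)
sumGraph {n₁} G₁ G₂ c = record
  { adj = λ u v → sumAdj (adj G₁) (adj G₂) c (splitAt n₁ u) (splitAt n₁ v)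
  ; sym = λ u v → sumAdj-sym G₁ G₂ c (splitAt n₁ u) (splitAt n₁ v)
  ; irrefl = λ u → sumAdj-irrefl G₁ G₂ c (splitAt n₁ u) }

_∪ᴳ_ : ∀ {n₁ n₂} → Graph n₁ → Graph n₂ → Graph (n₁ + n₂)
G₁ ∪ᴳ G₂ = sumGraph G₁ G₂ false

_∨ᴳ_ : ∀ {n₁ n₂} → Graph n₁ → Graph n₂ → Graph (n₁ + n₂)
G₁ ∨ᴳ G₂ = sumGraph G₁ G₂ true

Coloring : ℕ → ℕ → Set
Coloring n k = Fin n → Fin k

module _ {n k : ℕ} (G : Graph n) (c : Coloring n k) where

  AtLeast3Colors : ∀ {m} → (Fin m → Fin n) → Set
  AtLeast3Colors f = ∃[ i ] ∃[ j ] ∃[ l ]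
    (c (f i) ≢ c (f j) × c (f i) ≢ c (f l) × c (f j) ≢ c (f l))

  Proper : Set
  Proper = ∀ u v → Adj G u v → c u ≢ c v

  -- a cycle of length m+3 with distinct vertices f 0, ..., f (m+2)
  IsCycle : ∀ m → (Fin (suc (suc (suc m))) → Fin n) → Set
  IsCycle m f = Injective _≡_ _≡_ f
    × (∀ (i : Fin (suc (suc m))) → Adj G (f (inject₁ i)) (f (suc i)))
    × Adj G (f (fromℕ (suc (suc m)))) (f zero)

  Acyclic : Set
  Acyclic = Proper × (∀ m f → IsCycle m f → AtLeast3Colors f)

  IsP4 : (Fin 4 → Fin n) → Set
  IsP4 f = Injective _≡_ _≡_ f
    × Adj G (f f0) (f f1) × Adj G (f f1) (f f2) × Adj G (f f2) (f f3)
    × ¬ Adj G (f f0) (f f2) × ¬ Adj G (f f0) (f f3) × ¬ Adj G (f f1) (f f3)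
    where
    f0 f1 f2 f3 : Fin 4
    f0 = zero
    f1 = suc zero
    f2 = suc (suc zero)
    f3 = suc (suc (suc zero))

  Star : Set
  Star = Acyclic × (∀ f → IsP4 f → AtLeast3Colors f)

  -- a path v₁ ⋯ v_{2p} with p = q+1, distinct vertices, consecutive adjacent
  IsPath2p : ∀ q → (Fin (suc q + suc q) → Fin n) → Set
  IsPath2p q f = Injective _≡_ _≡_ f
    × (∀ (i : Fin (q + suc q)) → Adj G (f (inject₁ i)) (f (suc i)))

  Repetitive : ∀ q → (Fin (suc q + suc q) → Fin n) → Set
  Repetitive q f = ∀ (i : Fin (suc q)) → c (f (i ↑ˡ suc q)) ≡ c (f (suc q ↑ʳ i))

  Nonrepetitive : Set
  Nonrepetitive = Star × (∀ q f → IsPath2p q f → ¬ Repetitive q f)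

IsThueNumber : ∀ {n} → Graph n → ℕ → Set
IsThueNumber {n} G k =
  (Σ (Coloring n k) (Nonrepetitive G))
  × (∀ j (c : Coloring n j) → Nonrepetitive G c → k ≤ j)

module Submission where

-- A nonrepetitive colouring restricts to each part, which gives both lower bounds for the union, and a
-- walk in G₁ ∪ G₂ never changes parts, so gluing optimal colourings of G₁ and G₂ is nonrepetitive.
-- In G₁ ∨ G₂, an optimal colouring of G₁ together with a fresh private colour for each vertex of G₂
-- is nonrepetitive: a private colour cannot repeat along a path, and a vertex carrying one, together
-- with an edge avoiding it, puts three colours on any cycle or P₄. Conversely, if both parts contained
-- two vertices of equal colour, x y x′ y′ would be a repetitive path; so one part, say G₂, is rainbow,
-- and since G₂ is adjacent to all of G₁, G₁ needs k₁ colours besides those n₂.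

open import Defs
open import Data.Bool using (true; false; T)
open import Data.Empty using (⊥-elim)
open import Data.Fin using (Fin; zero; suc; inject₁; inject≤; fromℕ; splitAt; punchOut; _↑ˡ_; _↑ʳ_; _≟_)
open import Data.Fin.Properties
  using (¬Fin0; suc-injective; ↑ˡ-injective; ↑ʳ-injective; inject≤-injective; injective⇒≤;
         splitAt-↑ˡ; splitAt-↑ʳ; splitAt⁻¹-↑ˡ; splitAt⁻¹-↑ʳ; punchOut-injective; punchOut-cong; any?)
open import Data.Nat using (ℕ; zero; suc; _+_; _∸_; _≤_; _⊔_; _⊓_)
open import Data.Nat.Properties
  using (m≤m⊔n; m≤n⊔m; ⊔-lub; m⊓n≤m; m⊓n≤n; m≤n⇒m⊓n≡m; m≥n⇒m⊓n≡n; ≤-total; ≤-trans; m≤o∸n⇒m+n≤o)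
open import Data.Product using (Σ; ∃; _×_; _,_; proj₁; proj₂)
open import Data.Product.Function.NonDependent.Propositional using (_×-⇔_)
open import Data.Sum using (_⊎_; inj₁; inj₂; [_,_]′; swap)
open import Function using (_∘_)
open import Function.Bundles using (_⇔_; mk⇔; module Equivalence)
open import Function.Construct.Composition using (_⇔-∘_)
open import Function.Construct.Identity using (⇔-id)
open import Function.Definitions using (Injective)
open import Function.Related.TypeIsomorphisms using (¬-cong-⇔)
open import Relation.Binary.PropositionalEquality
  using (_≡_; _≢_; _≗_; refl; trans; cong; subst) renaming (sym to ≡-sym)
open import Relation.Nullary using (¬_; Dec; yes; no; ¬?)
open import Relation.Nullary.Decidable using (_×-dec_)

open Equivalence using (to; from)

Π-cong-⇔ : ∀ {A : Set} {P Q : A → Set} → (∀ x → P x ⇔ Q x) → (∀ x → P x) ⇔ (∀ x → Q x)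
Π-cong-⇔ P⇔Q = mk⇔ (λ p x → to (P⇔Q x) (p x)) (λ q x → from (P⇔Q x) (q x))

∃-cong-⇔ : ∀ {A : Set} {P Q : A → Set} → (∀ x → P x ⇔ Q x) → ∃ P ⇔ ∃ Q
∃-cong-⇔ P⇔Q = mk⇔ (λ (x , p) → x , to (P⇔Q x) p) (λ (x , q) → x , from (P⇔Q x) q)

all-or-some : ∀ {k} {P Q : Fin k → Set} → (∀ i → P i ⊎ Q i) → (∀ i → P i) ⊎ ∃ Q
all-or-some {zero} P⊎Q = inj₁ λ ()
all-or-some {suc k} P⊎Q with P⊎Q zero | all-or-some (P⊎Q ∘ suc)
... | inj₂ q | _            = inj₂ (zero , q)
... | inj₁ p | inj₁ ps      = inj₁ λ { zero → p ; (suc i) → ps i }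
... | inj₁ p | inj₂ (i , q) = inj₂ (suc i , q)

Image : ∀ {n m} → (Fin n → Fin m) → Fin m → Set
Image e u = ∃ λ x → u ≡ e x

↑ˡ≢↑ʳ : ∀ {m n} (i : Fin m) (j : Fin n) → i ↑ˡ n ≢ m ↑ʳ j
↑ˡ≢↑ʳ {m} {n} i j eq
  with trans (≡-sym (splitAt-↑ˡ m i n)) (trans (cong (splitAt m) eq) (splitAt-↑ʳ m n j))
... | ()

↑ˡ-or-↑ʳ : ∀ {m n} (u : Fin (m + n)) → Image (_↑ˡ n) u ⊎ Image (m ↑ʳ_) u
↑ˡ-or-↑ʳ {m} u with splitAt m u in eq
... | inj₁ x = inj₁ (x , ≡-sym (splitAt⁻¹-↑ˡ eq))
... | inj₂ y = inj₂ (y , ≡-sym (splitAt⁻¹-↑ʳ eq))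

module _ {m : ℕ} (G : Graph m) where

  Adj-sym : ∀ {u v} → Adj G u v → Adj G v u
  Adj-sym {u} {v} = subst T (sym G u v)

  Adj-irrefl : ∀ {u} → ¬ Adj G u u
  Adj-irrefl {u} = subst T (irrefl G u)

  Walk : ∀ {k} → (Fin (suc k) → Fin m) → Set
  Walk {k} f = ∀ (i : Fin k) → Adj G (f (inject₁ i)) (f (suc i))

  walk-within-part : ∀ {A B : Fin m → Set} → (∀ u → A u ⊎ B u) →
                     (∀ {u v} → A u → B v → ¬ Adj G u v) →
                     ∀ {k} (f : Fin (suc k) → Fin m) → Walk f → (∀ i → A (f i)) ⊎ (∀ i → B (f i))
  walk-within-part cover apart {zero} f _ with cover (f zero)
  ... | inj₁ a = inj₁ λ { zero → a }
  ... | inj₂ b = inj₂ λ { zero → b }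
  walk-within-part cover apart {suc k} f walk
    with cover (f zero) | walk-within-part cover apart (f ∘ suc) (walk ∘ suc)
  ... | inj₁ a | inj₁ as = inj₁ λ { zero → a ; (suc i) → as i }
  ... | inj₂ b | inj₂ bs = inj₂ λ { zero → b ; (suc i) → bs i }
  ... | inj₁ a | inj₂ bs = ⊥-elim (apart a (bs zero) (walk zero))
  ... | inj₂ b | inj₁ as = ⊥-elim (apart (as zero) b (Adj-sym (walk zero)))

record InducedEmbedding {n m : ℕ} (G : Graph n) (H : Graph m) : Set where
  field
    embed           : Fin n → Fin m
    embed-injective : Injective _≡_ _≡_ embed
    adj⇔            : ∀ x y → Adj H (embed x) (embed y) ⇔ Adj G x y
open InducedEmbedding

SameColorClasses : ∀ {n m k k′} → Coloring m k → (Fin n → Fin m) → Coloring n k′ → Set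
SameColorClasses c e c′ = ∀ x y → c (e x) ≡ c (e y) ⇔ c′ x ≡ c′ y

same-color-classes-via : ∀ {n m k k′} {c : Coloring m k} {e : Fin n → Fin m} {c′ : Coloring n k′}
  (ι : Fin k′ → Fin k) → Injective _≡_ _≡_ ι → c ∘ e ≗ ι ∘ c′ → SameColorClasses c e c′
same-color-classes-via ι ι-injective ce≗ιc′ x y = mk⇔
  (λ eq → ι-injective (trans (≡-sym (ce≗ιc′ x)) (trans eq (ce≗ιc′ y))))
  (λ eq → trans (ce≗ιc′ x) (trans (cong ι eq) (≡-sym (ce≗ιc′ y))))

module Transfer {n m kG kH : ℕ} {G : Graph n} {H : Graph m} {cG : Coloring n kG} {cH : Coloring m kH}
                (E : InducedEmbedding G H) (same : SameColorClasses cH (embed E) cG) where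

  module Over {k} {f : Fin k → Fin m} {f′ : Fin k → Fin n} (f≗ : f ≗ embed E ∘ f′) where

    adj-over⇔ : ∀ i j → Adj H (f i) (f j) ⇔ Adj G (f′ i) (f′ j)
    adj-over⇔ i j rewrite f≗ i | f≗ j = adj⇔ E (f′ i) (f′ j)

    color-over⇔ : ∀ i j → cH (f i) ≡ cH (f j) ⇔ cG (f′ i) ≡ cG (f′ j)
    color-over⇔ i j rewrite f≗ i | f≗ j = same (f′ i) (f′ j)

    injective-over⇔ : Injective _≡_ _≡_ f ⇔ Injective _≡_ _≡_ f′
    injective-over⇔ = mk⇔
      (λ f-inj {i} {j} eq → f-inj (trans (f≗ i) (trans (cong (embed E) eq) (≡-sym (f≗ j)))))
      (λ f′-inj {i} {j} eq → f′-inj (embed-injective E (trans (≡-sym (f≗ i)) (trans eq (f≗ j)))))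

    atLeast3Colors⇔ : AtLeast3Colors H cH f ⇔ AtLeast3Colors G cG f′
    atLeast3Colors⇔ = ∃-cong-⇔ λ i → ∃-cong-⇔ λ j → ∃-cong-⇔ λ l →
      ¬-cong-⇔ (color-over⇔ i j) ×-⇔ ¬-cong-⇔ (color-over⇔ i l) ×-⇔ ¬-cong-⇔ (color-over⇔ j l)

  open Over

  walk⇔ : ∀ {k} {f : Fin (suc k) → Fin m} {f′} → f ≗ embed E ∘ f′ → Walk H f ⇔ Walk G f′
  walk⇔ f≗ = Π-cong-⇔ λ i → adj-over⇔ f≗ _ _

  isCycle⇔ : ∀ {q f f′} → f ≗ embed E ∘ f′ → IsCycle H cH q f ⇔ IsCycle G cG q f′
  isCycle⇔ f≗ = injective-over⇔ f≗ ×-⇔ walk⇔ f≗ ×-⇔ adj-over⇔ f≗ _ _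

  isP4⇔ : ∀ {f f′} → f ≗ embed E ∘ f′ → IsP4 H cH f ⇔ IsP4 G cG f′
  isP4⇔ {f} {f′} f≗ = injective-over⇔ f≗ ×-⇔ edge _ _ ×-⇔ edge _ _ ×-⇔ edge _ _
                                       ×-⇔ nonEdge _ _ ×-⇔ nonEdge _ _ ×-⇔ nonEdge _ _
    where
    edge : ∀ i j → Adj H (f i) (f j) ⇔ Adj G (f′ i) (f′ j)
    edge = adj-over⇔ f≗
    nonEdge : ∀ i j → (¬ Adj H (f i) (f j)) ⇔ (¬ Adj G (f′ i) (f′ j))
    nonEdge i j = ¬-cong-⇔ (edge i j)

  isPath2p⇔ : ∀ {q f f′} → f ≗ embed E ∘ f′ → IsPath2p H cH q f ⇔ IsPath2p G cG q f′
  isPath2p⇔ f≗ = injective-over⇔ f≗ ×-⇔ walk⇔ f≗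

  repetitive⇔ : ∀ {q f f′} → f ≗ embed E ∘ f′ → Repetitive H cH q f ⇔ Repetitive G cG q f′
  repetitive⇔ f≗ = Π-cong-⇔ λ i → color-over⇔ f≗ _ _

  restrict : Nonrepetitive H cH → Nonrepetitive G cG
  restrict (((proper , cycles) , p4s) , paths) =
    ((proper′ , λ q f′ cyc → to (atLeast3Colors⇔ ≗-refl) (cycles q _ (from (isCycle⇔ ≗-refl) cyc))) ,
      λ f′ p4 → to (atLeast3Colors⇔ ≗-refl) (p4s _ (from (isP4⇔ ≗-refl) p4))) ,
      λ q f′ path rep →
        paths q _ (from (isPath2p⇔ ≗-refl) path) (from (repetitive⇔ {f′ = f′} ≗-refl) rep)
    where
    ≗-refl : ∀ {k} {f′ : Fin k → Fin n} → embed E ∘ f′ ≗ embed E ∘ f′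
    ≗-refl _ = refl
    proper′ : Proper G cG
    proper′ x y a eq = proper _ _ (from (adj⇔ E x y) a) (from (same x y) eq)

  private
    lift : ∀ {k} {f : Fin k → Fin m} (img : ∀ i → Image (embed E) (f i)) → f ≗ embed E ∘ (proj₁ ∘ img)
    lift img = proj₂ ∘ img

  proper-on-image : Nonrepetitive G cG → ∀ {u v} → Image (embed E) u → Image (embed E) v →
                    Adj H u v → cH u ≢ cH v
  proper-on-image (((proper , _) , _) , _) (x , refl) (y , refl) a eq =
    proper x y (to (adj⇔ E x y) a) (to (same x y) eq)

  cycle-on-image : Nonrepetitive G cG → ∀ {q f} → (∀ i → Image (embed E) (f i)) →
                   IsCycle H cH q f → AtLeast3Colors H cH f
  cycle-on-image (((_ , cycles) , _) , _) {q} img cyc =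
    from (atLeast3Colors⇔ (lift img)) (cycles q _ (to (isCycle⇔ (lift img)) cyc))

  p4-on-image : Nonrepetitive G cG → ∀ {f} → (∀ i → Image (embed E) (f i)) → IsP4 H cH f → AtLeast3Colors H cH f
  p4-on-image ((_ , p4s) , _) img p4 = from (atLeast3Colors⇔ (lift img)) (p4s _ (to (isP4⇔ (lift img)) p4))

  path-on-image : Nonrepetitive G cG → ∀ {q f} → (∀ i → Image (embed E) (f i)) →
                  IsPath2p H cH q f → ¬ Repetitive H cH q f
  path-on-image (_ , paths) {q} img path rep =
    paths q _ (to (isPath2p⇔ (lift img)) path) (to (repetitive⇔ (lift img)) rep)

module _ {n₁ n₂ m k₁ k₂ k : ℕ} {G₁ : Graph n₁} {G₂ : Graph n₂} {H : Graph m}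
         {c₁ : Coloring n₁ k₁} {c₂ : Coloring n₂ k₂} {c : Coloring m k}
         (E₁ : InducedEmbedding G₁ H) (same₁ : SameColorClasses c (embed E₁) c₁)
         (E₂ : InducedEmbedding G₂ H) (same₂ : SameColorClasses c (embed E₂) c₂)
         (cover : ∀ u → Image (embed E₁) u ⊎ Image (embed E₂) u)
         (apart : ∀ x y → ¬ Adj H (embed E₁ x) (embed E₂ y)) where

  nonrepetitive-union : Nonrepetitive G₁ c₁ → Nonrepetitive G₂ c₂ → Nonrepetitive H c
  nonrepetitive-union nr₁ nr₂ = ((proper , cycles) , p4s) , paths
    where
    module T₁ = Transfer {cH = c} E₁ same₁
    module T₂ = Transfer {cH = c} E₂ same₂

    apart′ : ∀ {u v} → Image (embed E₁) u → Image (embed E₂) v → ¬ Adj H u v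
    apart′ (x , refl) (y , refl) = apart x y

    within : ∀ {k} (f : Fin (suc k) → Fin m) → Walk H f →
             (∀ i → Image (embed E₁) (f i)) ⊎ (∀ i → Image (embed E₂) (f i))
    within = walk-within-part H cover apart′

    proper : Proper H c
    proper u v a with cover u | cover v
    ... | inj₁ x | inj₁ y = T₁.proper-on-image nr₁ x y a
    ... | inj₂ x | inj₂ y = T₂.proper-on-image nr₂ x y a
    ... | inj₁ x | inj₂ y = ⊥-elim (apart′ x y a)
    ... | inj₂ x | inj₁ y = ⊥-elim (apart′ y x (Adj-sym H a))

    cycles : ∀ q f → IsCycle H c q f → AtLeast3Colors H c f
    cycles q f cyc@(_ , walk , _) with within f walk
    ... | inj₁ img = T₁.cycle-on-image nr₁ img cyc
    ... | inj₂ img = T₂.cycle-on-image nr₂ img cyc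

    p4s : ∀ f → IsP4 H c f → AtLeast3Colors H c f
    p4s f p4@(_ , a₀₁ , a₁₂ , a₂₃ , _)
      with within f (λ { zero → a₀₁ ; (suc zero) → a₁₂ ; (suc (suc zero)) → a₂₃ })
    ... | inj₁ img = T₁.p4-on-image nr₁ img p4
    ... | inj₂ img = T₂.p4-on-image nr₂ img p4

    paths : ∀ q f → IsPath2p H c q f → ¬ Repetitive H c q f
    paths q f path@(_ , walk) with within f walk
    ... | inj₁ img = T₁.path-on-image nr₁ img path
    ... | inj₂ img = T₂.path-on-image nr₂ img path

PrivateColor : ∀ {m k} → Coloring m k → Fin m → Set
PrivateColor c u = ∀ v → c u ≡ c v → u ≡ v

module _ {n m k₁ k : ℕ} {G : Graph n} {H : Graph m} {c₁ : Coloring n k₁} {c : Coloring m k}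
         (E : InducedEmbedding G H) (same : SameColorClasses c (embed E) c₁)
         (cover : ∀ u → Image (embed E) u ⊎ PrivateColor c u) where

  nonrepetitive-with-private-colors : Nonrepetitive G c₁ → Nonrepetitive H c
  nonrepetitive-with-private-colors nr = ((proper , cycles) , p4s) , paths
    where
    open Transfer {cH = c} E same

    proper : Proper H c
    proper u v a eq with cover u | cover v
    ... | inj₁ x | inj₁ y = proper-on-image nr x y a eq
    ... | inj₂ private-u | _ = Adj-irrefl H (subst (λ w → Adj H w v) (private-u v eq) a)
    ... | inj₁ _ | inj₂ private-v = Adj-irrefl H (subst (λ w → Adj H u w) (private-v u (≡-sym eq)) a)

    private-three-colors : ∀ {k} {f : Fin k → Fin m} → Injective _≡_ _≡_ f →
                           ∀ i j l → PrivateColor c (f i) →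
                           i ≢ j → i ≢ l → Adj H (f j) (f l) → AtLeast3Colors H c f
    private-three-colors f-inj i j l private-i i≢j i≢l a =
      i , j , l , i≢j ∘ f-inj ∘ private-i _ , i≢l ∘ f-inj ∘ private-i _ , proper _ _ a

    cycles : ∀ q f → IsCycle H c q f → AtLeast3Colors H c f
    cycles q f cyc@(f-inj , walk , closing) with all-or-some (cover ∘ f)
    ... | inj₁ img = cycle-on-image nr img cyc
    ... | inj₂ (zero , p) =
      private-three-colors f-inj zero (suc zero) (suc (suc zero)) p (λ ()) (λ ()) (walk (suc zero))
    ... | inj₂ (suc zero , p) =
      private-three-colors f-inj (suc zero) (fromℕ (suc (suc q))) zero p (λ ()) (λ ()) closing
    ... | inj₂ (suc (suc i) , p) =
      private-three-colors f-inj (suc (suc i)) zero (suc zero) p (λ ()) (λ ()) (walk zero)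

    p4s : ∀ f → IsP4 H c f → AtLeast3Colors H c f
    p4s f p4@(f-inj , a₀₁ , a₁₂ , a₂₃ , _) with all-or-some (cover ∘ f)
    ... | inj₁ img = p4-on-image nr img p4
    ... | inj₂ (zero , p) =
      private-three-colors f-inj zero (suc zero) (suc (suc zero)) p (λ ()) (λ ()) a₁₂
    ... | inj₂ (suc zero , p) =
      private-three-colors f-inj (suc zero) (suc (suc zero)) (suc (suc (suc zero))) p (λ ()) (λ ()) a₂₃
    ... | inj₂ (suc (suc i) , p) =
      private-three-colors f-inj (suc (suc i)) zero (suc zero) p (λ ()) (λ ()) a₀₁

    paths : ∀ q f → IsPath2p H c q f → ¬ Repetitive H c q f
    paths q f path@(f-inj , _) rep with all-or-some (cover ∘ f)
    ... | inj₁ img = path-on-image nr img path rep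
    ... | inj₂ (i , p) with ↑ˡ-or-↑ʳ {suc q} i
    ...   | inj₁ (a , refl) = ↑ˡ≢↑ʳ a a (f-inj (p _ (rep a)))
    ...   | inj₂ (a , refl) = ↑ˡ≢↑ʳ a a (f-inj (≡-sym (p _ (≡-sym (rep a)))))

recolor-avoiding : ∀ {a b j} (d : Fin a → Fin j) (d′ : Fin b → Fin j) →
  Injective _≡_ _≡_ d′ → (∀ x y → d x ≢ d′ y) →
  Σ (Fin a → Fin (j ∸ b)) λ c′ → ∀ x y → d x ≡ d y ⇔ c′ x ≡ c′ y
recolor-avoiding {b = zero} d d′ _ _ = d , λ _ _ → ⇔-id _
recolor-avoiding {b = suc b} {zero} d d′ _ _ = ⊥-elim (¬Fin0 (d′ zero))
recolor-avoiding {b = suc b} {suc j} d d′ d′-inj avoid =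
  let c′ , same = recolor-avoiding (λ x → punchOut (avoid-zero x)) (λ y → punchOut (zero≢suc y))
        (λ {y} {y′} → suc-injective ∘ d′-inj ∘ punchOut-injective (zero≢suc y) (zero≢suc y′))
        (λ x y → avoid x (suc y) ∘ punchOut-injective (avoid-zero x) (zero≢suc y))
  in c′ , λ x y → same x y ⇔-∘ mk⇔ (punchOut-cong (d′ zero))
                                    (punchOut-injective (avoid-zero x) (avoid-zero y))
  where
  avoid-zero : ∀ x → d′ zero ≢ d x
  avoid-zero x = avoid x zero ∘ ≡-sym
  zero≢suc : ∀ y → d′ zero ≢ d′ (suc y)
  zero≢suc y eq with d′-inj eq
  ... | ()

Collision : ∀ {a k} → (Fin a → Fin k) → Set
Collision d = ∃ λ x → ∃ λ y → x ≢ y × d x ≡ d y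

collision? : ∀ {a k} (d : Fin a → Fin k) → Dec (Collision d)
collision? d = any? λ x → any? λ y → ¬? (x ≟ y) ×-dec (d x ≟ d y)

¬collision⇒injective : ∀ {a k} {d : Fin a → Fin k} → ¬ Collision d → Injective _≡_ _≡_ d
¬collision⇒injective {d = d} no-collision {x} {y} eq with x ≟ y
... | yes x≡y = x≡y
... | no x≢y = ⊥-elim (no-collision (x , y , x≢y , eq))

module _ {a b m k : ℕ} {H : Graph m} {c : Coloring m k}
         (e₁ : Fin a → Fin m) (e₂ : Fin b → Fin m)
         (e₁-injective : Injective _≡_ _≡_ e₁) (e₂-injective : Injective _≡_ _≡_ e₂)
         (complete : ∀ x y → Adj H (e₁ x) (e₂ y)) where

  complete-bipartite-rainbow-side : Nonrepetitive H c →
                                    Injective _≡_ _≡_ (c ∘ e₁) ⊎ Injective _≡_ _≡_ (c ∘ e₂)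
  complete-bipartite-rainbow-side nr with collision? (c ∘ e₁) | collision? (c ∘ e₂)
  ... | no none₁ | _ = inj₁ (¬collision⇒injective none₁)
  ... | yes _ | no none₂ = inj₂ (¬collision⇒injective none₂)
  ... | yes (x , x′ , x≢x′ , cx≡cx′) | yes (y , y′ , y≢y′ , cy≡cy′) =
    ⊥-elim (proj₂ nr 1 path (path-injective , walk) repetitive)
    where
    path : Fin 4 → Fin m
    path zero = e₁ x
    path (suc zero) = e₂ y
    path (suc (suc zero)) = e₁ x′
    path (suc (suc (suc zero))) = e₂ y′

    apart : ∀ x y → e₁ x ≢ e₂ y
    apart x y eq = Adj-irrefl H (subst (λ v → Adj H (e₁ x) v) (≡-sym eq) (complete x y))

    path-injective : Injective _≡_ _≡_ path
    path-injective {zero} {zero} _ = refl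
    path-injective {zero} {suc zero} eq = ⊥-elim (apart _ _ eq)
    path-injective {zero} {suc (suc zero)} eq = ⊥-elim (x≢x′ (e₁-injective eq))
    path-injective {zero} {suc (suc (suc zero))} eq = ⊥-elim (apart _ _ eq)
    path-injective {suc zero} {zero} eq = ⊥-elim (apart _ _ (≡-sym eq))
    path-injective {suc zero} {suc zero} _ = refl
    path-injective {suc zero} {suc (suc zero)} eq = ⊥-elim (apart _ _ (≡-sym eq))
    path-injective {suc zero} {suc (suc (suc zero))} eq = ⊥-elim (y≢y′ (e₂-injective eq))
    path-injective {suc (suc zero)} {zero} eq = ⊥-elim (x≢x′ (e₁-injective (≡-sym eq)))
    path-injective {suc (suc zero)} {suc zero} eq = ⊥-elim (apart _ _ eq)
    path-injective {suc (suc zero)} {suc (suc zero)} _ = refl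
    path-injective {suc (suc zero)} {suc (suc (suc zero))} eq = ⊥-elim (apart _ _ eq)
    path-injective {suc (suc (suc zero))} {zero} eq = ⊥-elim (apart _ _ (≡-sym eq))
    path-injective {suc (suc (suc zero))} {suc zero} eq = ⊥-elim (y≢y′ (e₂-injective (≡-sym eq)))
    path-injective {suc (suc (suc zero))} {suc (suc zero)} eq = ⊥-elim (apart _ _ (≡-sym eq))
    path-injective {suc (suc (suc zero))} {suc (suc (suc zero))} _ = refl

    walk : Walk H path
    walk zero = complete x y
    walk (suc zero) = Adj-sym H (complete x′ y)
    walk (suc (suc zero)) = complete x′ y′

    repetitive : Repetitive H c 1 path
    repetitive zero = cx≡cx′
    repetitive (suc zero) = cy≡cy′

complete-rainbow-bound : ∀ {n m b kG j : ℕ} {G : Graph n} {H : Graph m} {c : Coloring m j} →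
  IsThueNumber G kG → (E : InducedEmbedding G H) (e : Fin b → Fin m) → (∀ x y → Adj H (embed E x) (e y)) →
  Nonrepetitive H c → Injective _≡_ _≡_ (c ∘ e) → kG + b ≤ j
complete-rainbow-bound {c = c} (_ , minimal) E e complete nr ce-injective =
  let c′ , same = recolor-avoiding (c ∘ embed E) (c ∘ e) ce-injective
                    (λ x y → proj₁ (proj₁ (proj₁ nr)) _ _ (complete x y))
  in m≤o∸n⇒m+n≤o _ (injective⇒≤ ce-injective) (minimal _ c′ (Transfer.restrict E same nr))

rainbow-part-private : ∀ {a b m k} {c : Coloring m k} {e₁ : Fin a → Fin m} {e₂ : Fin b → Fin m} →
  (∀ u → Image e₁ u ⊎ Image e₂ u) → Injective _≡_ _≡_ (c ∘ e₂) →
  (∀ x y → c (e₁ x) ≢ c (e₂ y)) →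
  ∀ u → Image e₁ u ⊎ PrivateColor c u
rainbow-part-private cover ce₂-injective distinct u with cover u
... | inj₁ img = inj₁ img
... | inj₂ (y , refl) = inj₂ private-y
  where
  private-y : PrivateColor _ _
  private-y v eq with cover v
  ... | inj₁ (x , refl) = ⊥-elim (distinct x y (≡-sym eq))
  ... | inj₂ (y′ , refl) = cong _ (ce₂-injective eq)

module _ {n₁ n₂ : ℕ} (G₁ : Graph n₁) (G₂ : Graph n₂) where

  ↑ˡ-embedding : ∀ b → InducedEmbedding G₁ (sumGraph G₁ G₂ b)
  ↑ˡ-embedding b = record { embed = _↑ˡ n₂ ; embed-injective = ↑ˡ-injective n₂ _ _ ; adj⇔ = adj-↑ˡ⇔ }
    where
    adj-↑ˡ⇔ : ∀ x y → Adj (sumGraph G₁ G₂ b) (x ↑ˡ n₂) (y ↑ˡ n₂) ⇔ Adj G₁ x y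
    adj-↑ˡ⇔ x y rewrite splitAt-↑ˡ n₁ x n₂ | splitAt-↑ˡ n₁ y n₂ = ⇔-id _

  ↑ʳ-embedding : ∀ b → InducedEmbedding G₂ (sumGraph G₁ G₂ b)
  ↑ʳ-embedding b = record { embed = n₁ ↑ʳ_ ; embed-injective = ↑ʳ-injective n₁ _ _ ; adj⇔ = adj-↑ʳ⇔ }
    where
    adj-↑ʳ⇔ : ∀ x y → Adj (sumGraph G₁ G₂ b) (n₁ ↑ʳ x) (n₁ ↑ʳ y) ⇔ Adj G₂ x y
    adj-↑ʳ⇔ x y rewrite splitAt-↑ʳ n₁ n₂ x | splitAt-↑ʳ n₁ n₂ y = ⇔-id _

  ∪-apart : ∀ x y → ¬ Adj (G₁ ∪ᴳ G₂) (x ↑ˡ n₂) (n₁ ↑ʳ y)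
  ∪-apart x y rewrite splitAt-↑ˡ n₁ x n₂ | splitAt-↑ʳ n₁ n₂ y = λ ()

  ∨-complete : ∀ x y → Adj (G₁ ∨ᴳ G₂) (x ↑ˡ n₂) (n₁ ↑ʳ y)
  ∨-complete x y rewrite splitAt-↑ˡ n₁ x n₂ | splitAt-↑ʳ n₁ n₂ y = _

  glue : ∀ {k} → Coloring n₁ k → Coloring n₂ k → Coloring (n₁ + n₂) k
  glue c₁ c₂ = [ c₁ , c₂ ]′ ∘ splitAt n₁

  glue-↑ˡ : ∀ {k} (c₁ : Coloring n₁ k) (c₂ : Coloring n₂ k) x → glue c₁ c₂ (x ↑ˡ n₂) ≡ c₁ x
  glue-↑ˡ c₁ c₂ x = cong [ c₁ , c₂ ]′ (splitAt-↑ˡ n₁ x n₂)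

  glue-↑ʳ : ∀ {k} (c₁ : Coloring n₁ k) (c₂ : Coloring n₂ k) y → glue c₁ c₂ (n₁ ↑ʳ y) ≡ c₂ y
  glue-↑ʳ c₁ c₂ y = cong [ c₁ , c₂ ]′ (splitAt-↑ʳ n₁ n₂ y)

  module _ {k₁ k₂ : ℕ} (t₁ : IsThueNumber G₁ k₁) (t₂ : IsThueNumber G₂ k₂) where

    private
      c₁ = proj₁ (proj₁ t₁)
      c₂ = proj₁ (proj₁ t₂)

    union-thue : IsThueNumber (G₁ ∪ᴳ G₂) (k₁ ⊔ k₂)
    union-thue = (c , nonrepetitive-union (↑ˡ-embedding false) same₁ (↑ʳ-embedding false) same₂
                        ↑ˡ-or-↑ʳ ∪-apart (proj₂ (proj₁ t₁)) (proj₂ (proj₁ t₂)))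
               , λ j c′ nr → ⊔-lub (proj₂ t₁ j _ (Transfer.restrict (↑ˡ-embedding false) (λ _ _ → ⇔-id _) nr))
                                   (proj₂ t₂ j _ (Transfer.restrict (↑ʳ-embedding false) (λ _ _ → ⇔-id _) nr))
      where
      k₁≤ : k₁ ≤ k₁ ⊔ k₂
      k₁≤ = m≤m⊔n k₁ k₂
      k₂≤ : k₂ ≤ k₁ ⊔ k₂
      k₂≤ = m≤n⊔m k₁ k₂
      c : Coloring (n₁ + n₂) (k₁ ⊔ k₂)
      c = glue (λ x → inject≤ (c₁ x) k₁≤) (λ y → inject≤ (c₂ y) k₂≤)
      same₁ : SameColorClasses c (_↑ˡ n₂) c₁
      same₁ = same-color-classes-via {c = c} (λ z → inject≤ z k₁≤) (inject≤-injective k₁≤ k₁≤ _ _)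
                                     (glue-↑ˡ _ _)
      same₂ : SameColorClasses c (n₁ ↑ʳ_) c₂
      same₂ = same-color-classes-via {c = c} (λ z → inject≤ z k₂≤) (inject≤-injective k₂≤ k₂≤ _ _)
                                     (glue-↑ʳ _ _)

    join-coloringˡ : Σ (Coloring (n₁ + n₂) (k₁ + n₂)) (Nonrepetitive (G₁ ∨ᴳ G₂))
    join-coloringˡ = d , nonrepetitive-with-private-colors (↑ˡ-embedding true) same
                           (rainbow-part-private ↑ˡ-or-↑ʳ injective distinct) (proj₂ (proj₁ t₁))
      where
      d : Coloring (n₁ + n₂) (k₁ + n₂)
      d = glue (λ x → c₁ x ↑ˡ n₂) (k₁ ↑ʳ_)
      same : SameColorClasses d (_↑ˡ n₂) c₁
      same = same-color-classes-via {c = d} (_↑ˡ n₂) (↑ˡ-injective n₂ _ _) (glue-↑ˡ _ _)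
      injective : Injective _≡_ _≡_ (d ∘ (n₁ ↑ʳ_))
      injective {y} {y′} eq = ↑ʳ-injective k₁ _ _ (trans (≡-sym (glue-↑ʳ _ _ y)) (trans eq (glue-↑ʳ _ _ y′)))
      distinct : ∀ x y → d (x ↑ˡ n₂) ≢ d (n₁ ↑ʳ y)
      distinct x y eq = ↑ˡ≢↑ʳ (c₁ x) y (trans (≡-sym (glue-↑ˡ _ _ x)) (trans eq (glue-↑ʳ _ _ y)))

    join-coloringʳ : Σ (Coloring (n₁ + n₂) (k₂ + n₁)) (Nonrepetitive (G₁ ∨ᴳ G₂))
    join-coloringʳ = d , nonrepetitive-with-private-colors (↑ʳ-embedding true) same
                           (rainbow-part-private (swap ∘ ↑ˡ-or-↑ʳ) injective distinct) (proj₂ (proj₁ t₂))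
      where
      d : Coloring (n₁ + n₂) (k₂ + n₁)
      d = glue (k₂ ↑ʳ_) (λ y → c₂ y ↑ˡ n₁)
      same : SameColorClasses d (n₁ ↑ʳ_) c₂
      same = same-color-classes-via {c = d} (_↑ˡ n₁) (↑ˡ-injective n₁ _ _) (glue-↑ʳ _ _)
      injective : Injective _≡_ _≡_ (d ∘ (_↑ˡ n₂))
      injective {x} {x′} eq = ↑ʳ-injective k₂ _ _ (trans (≡-sym (glue-↑ˡ _ _ x)) (trans eq (glue-↑ˡ _ _ x′)))
      distinct : ∀ y x → d (n₁ ↑ʳ y) ≢ d (x ↑ˡ n₂)
      distinct y x eq = ↑ˡ≢↑ʳ (c₂ y) x (trans (≡-sym (glue-↑ʳ _ _ y)) (trans eq (glue-↑ˡ _ _ x)))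

    join-upper : Σ (Coloring (n₁ + n₂) ((k₁ + n₂) ⊓ (k₂ + n₁))) (Nonrepetitive (G₁ ∨ᴳ G₂))
    join-upper with ≤-total (k₁ + n₂) (k₂ + n₁)
    ... | inj₁ le rewrite m≤n⇒m⊓n≡m le = join-coloringˡ
    ... | inj₂ le rewrite m≥n⇒m⊓n≡n le = join-coloringʳ

    join-lower : ∀ j (c : Coloring (n₁ + n₂) j) → Nonrepetitive (G₁ ∨ᴳ G₂) c →
                 (k₁ + n₂) ⊓ (k₂ + n₁) ≤ j
    join-lower j c nr
      with complete-bipartite-rainbow-side {H = G₁ ∨ᴳ G₂} (_↑ˡ n₂) (n₁ ↑ʳ_)
             (↑ˡ-injective n₂ _ _) (↑ʳ-injective n₁ _ _) ∨-complete nr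
    ... | inj₁ rainbowˡ = ≤-trans (m⊓n≤n _ _) (complete-rainbow-bound t₂ (↑ʳ-embedding true) (_↑ˡ n₂)
                                                  (λ y x → Adj-sym (G₁ ∨ᴳ G₂) (∨-complete x y)) nr rainbowˡ)
    ... | inj₂ rainbowʳ = ≤-trans (m⊓n≤m _ _)
                                  (complete-rainbow-bound t₁ (↑ˡ-embedding true) (n₁ ↑ʳ_) ∨-complete nr rainbowʳ)

lemma3p2 : ∀ {n₁ n₂ : ℕ} (G₁ : Graph n₁) (G₂ : Graph n₂) (k₁ k₂ : ℕ) →
    IsThueNumber G₁ k₁ → IsThueNumber G₂ k₂ →
    IsThueNumber (G₁ ∪ᴳ G₂) (k₁ ⊔ k₂)
    × IsThueNumber (G₁ ∨ᴳ G₂) ((k₁ + n₂) ⊓ (k₂ + n₁))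
lemma3p2 G₁ G₂ k₁ k₂ t₁ t₂ =
  union-thue G₁ G₂ t₁ t₂ , (join-upper G₁ G₂ t₁ t₂ , join-lower G₁ G₂ t₁ t₂)
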